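{- For every formal power series $F(x)=f_0+f_1x+f_2x^2+\cdots$ and every integer $n\ge2$, \[H^{(2)}_{n-1}(F)=-H_n(-1+F)+H_n(F).\]
   Context: For a power series $F=\sum_{n\ge0}f_nx^n$, $n\ge1$ and $k\ge0$, $H^{(k)}_n(F)=\det(f_{k+i+j})_{0\le i,j\le n-1}$ and $H_n(F)=H^{(0)}_n(F)$; $-1+F$ denotes the series $F(x)-1$. -}

module Defs where

open import Level using (Level)
open import Data.Nat using (ℕ; zero; suc) renaming (_+_ to _+ℕ_)
open import Data.Fin using (Fin; zero; suc; toℕ; punchIn)
open import Algebra.Bundles using (CommutativeRing)

-- Formal power series over a commutative ring: coefficient sequences.
module _ {c ℓ : Level} (R : CommutativeRing c ℓ) where
  open CommutativeRing R using (Carrier; _+_; _*_; -_; 0#; 1#)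

  sumFin : (n : ℕ) → (Fin n → Carrier) → Carrier
  sumFin zero    f = 0#
  sumFin (suc n) f = f zero + sumFin n (λ j → f (suc j))

  sign : ℕ → Carrier
  sign zero    = 1#
  sign (suc k) = - sign k

  minor : {n : ℕ} → (Fin (suc n) → Fin (suc n) → Carrier) → Fin (suc n)
        → Fin n → Fin n → Carrier
  minor M j i k = M (suc i) (punchIn j k)

  det : (n : ℕ) → (Fin n → Fin n → Carrier) → Carrier
  det zero    M = 1#
  det (suc n) M =
    sumFin (suc n) (λ j → sign (toℕ j) * (M zero j * det n (minor M j)))

  hankel : (k n : ℕ) → (ℕ → Carrier) → Carrier
  hankel k n f = det n (λ i j → f (k +ℕ toℕ i +ℕ toℕ j))

  minusOnePlus : (ℕ → Carrier) → (ℕ → Carrier)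
  minusOnePlus f zero    = - 1# + f zero
  minusOnePlus f (suc m) = f (suc m)

{-# OPTIONS --safe #-}
-- Expanding along the first row, the determinant is an affine function of the
-- top-left entry whose slope is the complementary minor.  The Hankel matrices
-- of F and −1 + F differ only in that entry, by −1, and the complementary
-- minor of (f_{i+j}) is (f_{2+i+j}).
module Submission where

open import Defs
open import Level using (Level)
open import Data.Nat using (ℕ; zero; suc; _≤_; _∸_; s≤s) renaming (_+_ to _+ℕ_)
open import Data.Nat.Properties using (+-suc)
open import Data.Fin using (Fin; zero; suc; toℕ; punchIn)
open import Algebra.Bundles using (CommutativeRing)
import Algebra.Properties.Ring as RingProperties
open import Relation.Binary.PropositionalEquality using (_≡_; refl; cong; cong₂; trans)
import Relation.Binary.Reasoning.Setoid as SetoidReasoning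

module _ {c ℓ : Level} (R : CommutativeRing c ℓ) where
  open CommutativeRing R
    using (Carrier; _≈_; _+_; _*_; -_; 1#; setoid; ring; +-congʳ; +-congˡ; +-assoc; -‿cong; *-identityˡ; distribʳ)
  open RingProperties ring using (-1*x≈-x; -‿+-comm; //-rightDividesˡ; -‿involutive)
  open SetoidReasoning setoid

  hankelMatrix : (k n : ℕ) → (ℕ → Carrier) → Fin n → Fin n → Carrier
  hankelMatrix k n f i j = f (k +ℕ toℕ i +ℕ toℕ j)

  sumFin-cong : ∀ n {f g : Fin n → Carrier} → (∀ j → f j ≡ g j) → sumFin R n f ≡ sumFin R n g
  sumFin-cong zero    f≡g = refl
  sumFin-cong (suc n) f≡g = cong₂ _+_ (f≡g zero) (sumFin-cong n (λ j → f≡g (suc j)))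

  det-cong : ∀ n {M N : Fin n → Fin n → Carrier} → (∀ i j → M i j ≡ N i j) → det R n M ≡ det R n N
  det-cong zero    M≡N = refl
  det-cong (suc n) M≡N = sumFin-cong (suc n) λ j →
    cong₂ (λ x y → sign R (toℕ j) * (x * y)) (M≡N zero j) (det-cong n (λ i k → M≡N (suc i) (punchIn j k)))

  1*[a+m]d+s≈ad+[1*md+s] : ∀ a m d s → 1# * ((a + m) * d) + s ≈ a * d + (1# * (m * d) + s)
  1*[a+m]d+s≈ad+[1*md+s] a m d s = begin
    1# * ((a + m) * d) + s    ≈⟨ +-congʳ (*-identityˡ _) ⟩
    (a + m) * d + s           ≈⟨ +-congʳ (distribʳ d a m) ⟩
    a * d + m * d + s         ≈⟨ +-assoc _ _ _ ⟩
    a * d + (m * d + s)       ≈⟨ +-congˡ (+-congʳ (*-identityˡ _)) ⟨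
    a * d + (1# * (m * d) + s) ∎

  det-shiftTopLeft : ∀ n (a : Carrier) (M N : Fin (suc n) → Fin (suc n) → Carrier) →
                     N zero zero ≡ a + M zero zero →
                     (∀ j → N zero (suc j) ≡ M zero (suc j)) →
                     (∀ i j → N (suc i) j ≡ M (suc i) j) →
                     det R (suc n) N ≈ a * det R n (minor R M zero) + det R (suc n) M
  det-shiftTopLeft n a M N topLeft firstRow lowerRows = begin
    det R (suc n) N
      ≡⟨ cong₂ (λ x y → 1# * x + y)
           (cong₂ _*_ topLeft (det-cong n (λ i k → lowerRows i (suc k))))
           (sumFin-cong n λ j → cong₂ (λ x y → sign R (suc (toℕ j)) * (x * y))
              (firstRow j) (det-cong n (λ i k → lowerRows i (punchIn (suc j) k)))) ⟩
    1# * ((a + M zero zero) * D) + S ≈⟨ 1*[a+m]d+s≈ad+[1*md+s] a (M zero zero) D S ⟩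
    a * D + det R (suc n) M ∎
    where
    D S : Carrier
    D = det R n (minor R M zero)
    S = sumFin R n λ j → sign R (suc (toℕ j)) * (M zero (suc j) * det R n (minor R M (suc j)))

  det-minor-hankelMatrix : ∀ k n f → det R n (minor R (hankelMatrix k (suc n) f) zero) ≡ hankel R (2 +ℕ k) n f
  det-minor-hankelMatrix k n f = det-cong n λ i j →
    cong f (trans (cong (_+ℕ suc (toℕ j)) (+-suc k (toℕ i))) (cong suc (+-suc (k +ℕ toℕ i) (toℕ j))))

  -[-x+y]+y≈x : ∀ x y → - (- 1# * x + y) + y ≈ x
  -[-x+y]+y≈x x y = begin
    - (- 1# * x + y) + y      ≈⟨ +-congʳ (-‿+-comm _ y) ⟨
    - (- 1# * x) + - y + y    ≈⟨ //-rightDividesˡ y _ ⟩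
    - (- 1# * x)              ≈⟨ -‿cong (-1*x≈-x x) ⟩
    - - x                     ≈⟨ -‿involutive x ⟩
    x                         ∎

lemma2p2 : {c ℓ : Level} (R : CommutativeRing c ℓ) (F : ℕ → CommutativeRing.Carrier R) (n : ℕ) → 2 ≤ n →
    CommutativeRing._≈_ R (hankel R 2 (n ∸ 1) F)
      (CommutativeRing._+_ R (CommutativeRing.-_ R (hankel R 0 n (minusOnePlus R F))) (hankel R 0 n F))
lemma2p2 R F (suc (suc m)) (s≤s (s≤s _)) = begin
  hankel R 2 (suc m) F  ≡⟨ det-minor-hankelMatrix R 0 (suc m) F ⟨
  D                     ≈⟨ -[-x+y]+y≈x R D (det R n M) ⟨
  - (- 1# * D + det R n M) + det R n M
    ≈⟨ +-congʳ (-‿cong (det-shiftTopLeft R (suc m) (- 1#) M M₋₁ refl (λ _ → refl) (λ _ _ → refl))) ⟨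
  - det R n M₋₁ + det R n M ∎
  where
  open CommutativeRing R using (Carrier; _+_; _*_; -_; 1#; setoid; +-congʳ; -‿cong)
  open SetoidReasoning setoid
  n : ℕ
  n = suc (suc m)
  M M₋₁ : Fin n → Fin n → Carrier
  M   = hankelMatrix R 0 n F
  M₋₁ = hankelMatrix R 0 n (minusOnePlus R F)
  D : Carrier
  D = det R (suc m) (minor R M zero)
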